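{- Let $p$ be a prime, $\ell\ge1$, and let $f\in P_{p^\ell}$ be a nilpotent periodic sequence. If $e_\gamma$ is the leading component of its generating vector $\mathrm{vect}(f)$, then $\tau(\Sigma^sf)=\tau(\Sigma^{s+\gamma}[e_\gamma])$ for all sufficiently large $s$.
   Context: $P_{p^\ell}$ is the module of periodic sequences $\mathbb{N}\to\mathbb{Z}_{p^\ell}$, and $\tau$ denotes the (minimal) period. $\Delta f(n)=f(n+1)-f(n)$. A sequence $f$ is nilpotent if $\Delta^\eta f=0$ for some $\eta\ge1$; the minimal such $\eta$ is the nilpotency index. The generating vector is $\mathrm{vect}(f)=(e_0,\dots,e_{\eta-1})$ with $e_i=\Delta^if(0)$. The leading component is the last entry $e_\gamma$ of $\mathrm{vect}(f)$ having minimal $p$-adic valuation, where on $\mathbb{Z}_{p^\ell}$ the valuation of $0$ is $\infty$. $[c]$ is the constant sequence with value $c$. $\Sigma$ is the sum operator $\Sigma f(0)=0$, $\Sigma f(n)=f(n-1)+\Sigma f(n-1)$. -}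

module Defs where

open import Data.Nat as ℕ using (ℕ; zero; suc; _^_)
open import Data.Integer as ℤ using (ℤ; +_; _-_; _+_)
open import Data.Integer.Divisibility using (_∣_)
open import Data.Product using (_×_; Σ; ∃)
open import Relation.Nullary using (¬_)

-- Elements of ℤ_{m} are represented by integers; equality in ℤ_m is
-- congruence modulo m.
_≡_[mod_] : ℤ → ℤ → ℕ → Set
a ≡ b [mod m ] = (+ m) ∣ (a - b)

-- Sequences ℕ → ℤ_m, represented as ℕ → ℤ.
Seq : Set
Seq = ℕ → ℤ

Δ : Seq → Seq
Δ f n = f (suc n) - f n

Δ^ : ℕ → Seq → Seq
Δ^ zero    f = f
Δ^ (suc k) f = Δ (Δ^ k f)

Sum : Seq → Seq
Sum f zero    = + 0
Sum f (suc n) = f n + Sum f n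

Sum^ : ℕ → Seq → Seq
Sum^ zero    f = f
Sum^ (suc s) f = Sum (Sum^ s f)

[_] : ℤ → Seq
[ c ] _ = c

IsPeriod : ℕ → Seq → ℕ → Set
IsPeriod m f T = (1 ℕ.≤ T) × (∀ n → f (n ℕ.+ T) ≡ f n [mod m ])

Periodic : ℕ → Seq → Set
Periodic m f = ∃ λ T → IsPeriod m f T

IsMinPeriod : ℕ → Seq → ℕ → Set
IsMinPeriod m f T = IsPeriod m f T × (∀ T' → IsPeriod m f T' → T ℕ.≤ T')

IsZeroSeq : ℕ → Seq → Set
IsZeroSeq m f = ∀ n → f n ≡ + 0 [mod m ]

IsNilpotencyIndex : ℕ → Seq → ℕ → Set
IsNilpotencyIndex m f η =
  (1 ℕ.≤ η) × IsZeroSeq m (Δ^ η f) ×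
  (∀ η' → 1 ℕ.≤ η' → IsZeroSeq m (Δ^ η' f) → η ℕ.≤ η')

-- e_i = Δ^i f (0), the i-th entry of vect(f)
vectEntry : Seq → ℕ → ℤ
vectEntry f i = Δ^ i f 0

-- p-adic valuation on ℤ_{p^ℓ} (valuation of 0 is ∞, i.e. ≥ ℓ):
-- v(a) ≤ v(b)  iff every p^k (k ≤ ℓ) dividing a (in ℤ_{p^ℓ}) divides b.
-- Divisibility by p^k (k ≤ ℓ) in ℤ_{p^ℓ} coincides with divisibility in ℤ
-- of any representative.
ValLe : ℕ → ℕ → ℤ → ℤ → Set
ValLe p ℓ a b = ∀ k → k ℕ.≤ ℓ → (+ (p ^ k)) ∣ a → (+ (p ^ k)) ∣ b

-- v(a) < v(b)  iff some p^k (k ≤ ℓ) divides b but not a.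
ValLt : ℕ → ℕ → ℤ → ℤ → Set
ValLt p ℓ a b = ∃ λ k → (k ℕ.≤ ℓ) × ((+ (p ^ k)) ∣ b) × ¬ ((+ (p ^ k)) ∣ a)

-- Given the nilpotency index η of f, γ indexes the leading component of
-- vect(f) = (e_0, …, e_{η-1}): the LAST entry of minimal p-adic valuation.
IsLeadingIndex : ℕ → ℕ → Seq → ℕ → ℕ → Set
IsLeadingIndex p ℓ f η γ =
  (γ ℕ.< η) ×
  (∀ i → i ℕ.< η → ValLe p ℓ (vectEntry f γ) (vectEntry f i)) ×
  (∀ i → γ ℕ.< i → i ℕ.< η → ValLt p ℓ (vectEntry f γ) (vectEntry f i))

-- Write e_i = Δ^i f(0) and g = Σ^s f. The difference vector of g at 0 is e shifted by s, so its
-- leading entry e_γ sits at d = s + γ. By Newton's formula g(n + T) = Σ_j C(T,j) Δ^j g(n), T is a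
-- period mod p^ℓ iff Σ_{j≥1} C(T,j) Δ^{j+k} g(0) ≡ 0 for every k. Let v = v_p(e_γ) < ℓ and
-- p^L ≤ d < p^(L+1). Since v_p C(p^m, j) ≥ m − v_p(j), all these terms vanish for T = p^(ℓ−v+L);
-- for T = p^(ℓ−v+L−1) and k = d − p^L all terms but the one with j = p^L vanish, and that one has
-- valuation exactly ℓ − 1 because C(p^m, p^L) = p^(m−L) u with p ∤ u. Periods are closed under
-- gcd, so the periods of g are exactly the multiples of p^(ℓ−v+L). This depends only on v and d,
-- which Σ^(s+γ)[e_γ] shares with g. The bound s ≥ pη keeps the nonzero entries after d within
-- distance p^L of it, which the count above needs. If e_γ ≡ 0 then, e_γ being of minimal
-- valuation, f ≡ 0 and both sums vanish.

module Submission where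

open import Defs
open import Data.Nat
  using (ℕ; zero; suc; pred; _+_; _*_; _^_; _∸_; _≤_; _<_; z≤n; s≤s; NonZero; nonTrivial⇒n>1)
import Data.Nat.Properties as ℕ
open import Data.Nat.Primality using (Prime; euclidsLemma; prime⇒nonZero; prime⇒nonTrivial)
open import Data.Nat.Divisibility
  using (_∣_; _∣0; _∣?_; ∣-trans; divides; divides-refl; 1∣_; ∣1⇒≡1; >⇒∤; *-pres-∣; ∣m+n∣m⇒∣n;
         m∣m*n; m*n∣⇒m∣; *-monoʳ-∣; *-cancelˡ-∣)
open import Data.Nat.GCD using (gcd; gcd-GCD; gcd[m,n]∣m; gcd[m,n]∣n; module Bézout)
open import Data.Nat.Combinatorics using (_C_; nC1≡n; nCk+nC[k+1]≡[n+1]C[k+1]; k>n⇒nCk≡0)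
open import Data.Integer using (ℤ; +_)
import Data.Integer.Base as ℤ using (_+_; _-_; _*_; ∣_∣)
import Data.Integer.Properties as ℤᵖ
import Data.Integer.Divisibility.Signed as ℤᵈ
open ℤᵈ using () renaming (_∣_ to _∣ℤ_)
open import Data.Integer.Tactic.RingSolver using (solve-∀)
open import Data.Nat.Tactic.RingSolver using () renaming (solve-∀ to ℕ-solve-∀)
open import Data.Product using (∃; _×_; _,_; proj₁; proj₂)
open import Relation.Nullary using (¬_; yes; no)
open import Data.Empty using (⊥-elim)
open import Data.Sum using (_⊎_; inj₁; inj₂)
open import Relation.Binary.PropositionalEquality hiding ([_])
open import Function.Base using (_∘_; flip)
open import Function.Bundles using (_⇔_; mk⇔; Equivalence)
open import Function.Properties.Equivalence using () renaming (sym to ⇔-sym; trans to ⇔-trans)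
open import Relation.Binary.Definitions using (tri<; tri≈; tri>)

-- Finite sums

∑ : ℕ → (ℕ → ℤ) → ℤ
∑ zero    h = + 0
∑ (suc N) h = h 0 ℤ.+ ∑ N (λ j → h (suc j))

syntax ∑ N (λ j → t) = ∑[ j < N ] t

∑-cong : ∀ N {h h′ : ℕ → ℤ} → (∀ j → h j ≡ h′ j) → ∑ N h ≡ ∑ N h′
∑-cong zero    eq = refl
∑-cong (suc N) eq = cong₂ ℤ._+_ (eq 0) (∑-cong N (λ j → eq (suc j)))

∑-distrib-+ : ∀ N (h h′ : ℕ → ℤ) → ∑[ j < N ] (h j ℤ.+ h′ j) ≡ ∑ N h ℤ.+ ∑ N h′
∑-distrib-+ zero    h h′ = refl
∑-distrib-+ (suc N) h h′ =
  trans (cong ((h 0 ℤ.+ h′ 0) ℤ.+_) (∑-distrib-+ N (λ j → h (suc j)) (λ j → h′ (suc j))))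
        (interchange (h 0) (h′ 0) _ _)
  where
  interchange : ∀ a b c d → (a ℤ.+ b) ℤ.+ (c ℤ.+ d) ≡ (a ℤ.+ c) ℤ.+ (b ℤ.+ d)
  interchange = solve-∀

∑-snoc : ∀ N (h : ℕ → ℤ) → ∑ (suc N) h ≡ ∑ N h ℤ.+ h N
∑-snoc zero    h = ℤᵖ.+-comm (h 0) (+ 0)
∑-snoc (suc N) h =
  trans (cong (h 0 ℤ.+_) (∑-snoc N (λ j → h (suc j)))) (sym (ℤᵖ.+-assoc (h 0) _ _))

∣ℤ0 : ∀ {k} → k ∣ℤ + 0
∣ℤ0 = ℤᵈ.divides (+ 0) refl

∑-∣ : ∀ {k} N {h : ℕ → ℤ} → (∀ j → k ∣ℤ h j) → k ∣ℤ ∑ N h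
∑-∣ zero    k∣h = ∣ℤ0
∑-∣ (suc N) k∣h = ℤᵈ.∣m∣n⇒∣m+n (k∣h 0) (∑-∣ N (λ j → k∣h (suc j)))

∑-∤ : ∀ {k} N {h : ℕ → ℤ} {j₀} → j₀ < N →
      (∀ j → j ≢ j₀ → k ∣ℤ h j) → ¬ k ∣ℤ h j₀ → ¬ k ∣ℤ ∑ N h
∑-∤ (suc N) {j₀ = zero} _ others k∤h₀ k∣∑ =
  k∤h₀ (ℤᵈ.∣m+n∣n⇒∣m k∣∑ (∑-∣ N (λ j → others (suc j) λ ())))
∑-∤ (suc N) {j₀ = suc j₀} (s≤s j₀<N) others k∤h k∣∑ =
  ∑-∤ N j₀<N (λ j j≢j₀ → others (suc j) (j≢j₀ ∘ ℕ.suc-injective)) k∤h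
      (ℤᵈ.∣m+n∣m⇒∣n k∣∑ (others 0 λ ()))

∑-cong-mod : ∀ {k} N {h h′ : ℕ → ℤ} → (∀ j → k ∣ℤ h j ℤ.- h′ j) → k ∣ℤ ∑ N h ℤ.- ∑ N h′
∑-cong-mod zero    _  = ∣ℤ0
∑-cong-mod (suc N) {h} {h′} k∣h-h′ =
  subst (_ ∣ℤ_) (regroup (h 0) (h′ 0) (∑ N (λ j → h (suc j))) (∑ N (λ j → h′ (suc j))))
        (ℤᵈ.∣m∣n⇒∣m+n (k∣h-h′ 0) (∑-cong-mod N (λ j → k∣h-h′ (suc j))))
  where
  regroup : ∀ a b c d → (a ℤ.- b) ℤ.+ (c ℤ.- d) ≡ (a ℤ.+ c) ℤ.- (b ℤ.+ d)
  regroup = solve-∀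

-- Finite differences and Newton's formula

Δ^-cong : ∀ k {g h : Seq} → (∀ n → g n ≡ h n) → ∀ n → Δ^ k g n ≡ Δ^ k h n
Δ^-cong zero    g≗h = g≗h
Δ^-cong (suc k) g≗h n = cong₂ ℤ._-_ (Δ^-cong k g≗h (suc n)) (Δ^-cong k g≗h n)

Δ^-+ : ∀ j k g n → Δ^ (j + k) g n ≡ Δ^ j (Δ^ k g) n
Δ^-+ zero    k g n = refl
Δ^-+ (suc j) k g n = cong₂ ℤ._-_ (Δ^-+ j k g (suc n)) (Δ^-+ j k g n)

Δ^-suc : ∀ k g n → Δ^ (suc k) g n ≡ Δ^ k (Δ g) n
Δ^-suc zero    g n = refl
Δ^-suc (suc k) g n = cong₂ ℤ._-_ (Δ^-suc k g (suc n)) (Δ^-suc k g n)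

Δ^-∣ : ∀ {m} k {g : Seq} → (∀ n → m ∣ℤ g n) → ∀ n → m ∣ℤ Δ^ k g n
Δ^-∣ zero    m∣g = m∣g
Δ^-∣ (suc k) m∣g n = ℤᵈ.∣m∣n⇒∣m-n (Δ^-∣ k m∣g (suc n)) (Δ^-∣ k m∣g n)

Δ^-beyond-nilpotency : ∀ {k η t} f → (∀ n → k ∣ℤ Δ^ η f n) → η ≤ t → k ∣ℤ Δ^ t f 0
Δ^-beyond-nilpotency {k} {η} {t} f k∣Δ^ηf η≤t =
  subst (λ j → k ∣ℤ Δ^ j f 0) (ℕ.m∸n+n≡m η≤t)
        (subst (k ∣ℤ_) (sym (Δ^-+ (t ∸ η) η f 0)) (Δ^-∣ (t ∸ η) k∣Δ^ηf 0))

Δ^-step : ∀ k g n → Δ^ k g (suc n) ≡ Δ^ k g n ℤ.+ Δ^ (suc k) g n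
Δ^-step k g n = restore (Δ^ k g (suc n)) (Δ^ k g n)
  where
  restore : ∀ a b → a ≡ b ℤ.+ (a ℤ.- b)
  restore = solve-∀

Δ^-of-increments : ∀ k T g n →
  Δ^ k (λ n → g (n + T) ℤ.- g n) n ≡ Δ^ k g (n + T) ℤ.- Δ^ k g n
Δ^-of-increments zero    T g n = refl
Δ^-of-increments (suc k) T g n =
  trans (cong₂ ℤ._-_ (Δ^-of-increments k T g (suc n)) (Δ^-of-increments k T g n))
        (interchange (Δ^ k g (suc (n + T))) (Δ^ k g (suc n)) (Δ^ k g (n + T)) (Δ^ k g n))
  where
  interchange : ∀ a b c d → (a ℤ.- b) ℤ.- (c ℤ.- d) ≡ (a ℤ.- c) ℤ.- (b ℤ.- d)
  interchange = solve-∀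

[c]-nilpotent : ∀ {k} c n → k ∣ℤ Δ^ 1 [ c ] n
[c]-nilpotent c n = subst (_ ∣ℤ_) (sym (ℤᵖ.+-inverseʳ c)) ∣ℤ0

Δ^-Sum^ : ∀ i r g n → Δ^ i (Sum^ (i + r) g) n ≡ Sum^ r g n
Δ^-Sum^ zero    r g n = refl
Δ^-Sum^ (suc i) r g n = begin
  Δ^ (suc i) (Sum (Sum^ (i + r) g)) n  ≡⟨ Δ^-suc i _ n ⟩
  Δ^ i (Δ (Sum (Sum^ (i + r) g))) n    ≡⟨ Δ^-cong i (Δ-Sum (Sum^ (i + r) g)) n ⟩
  Δ^ i (Sum^ (i + r) g) n              ≡⟨ Δ^-Sum^ i r g n ⟩
  Sum^ r g n                           ∎
  where
  open ≡-Reasoning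
  Δ-Sum : ∀ h n → Δ (Sum h) n ≡ h n
  Δ-Sum h n = cancel (h n) (Sum h n)
    where
    cancel : ∀ a b → (a ℤ.+ b) ℤ.- b ≡ a
    cancel = solve-∀

Δ^-Sum^-below : ∀ {i s} g → i < s → Δ^ i (Sum^ s g) 0 ≡ + 0
Δ^-Sum^-below {i} {s} g i<s =
  subst (λ s → Δ^ i (Sum^ s g) 0 ≡ + 0) (trans (ℕ.+-suc i (s ∸ suc i)) (ℕ.m+[n∸m]≡n i<s))
        (Δ^-Sum^ i (suc (s ∸ suc i)) g 0)

Δ^-Sum^-above : ∀ t s g n → Δ^ (t + s) (Sum^ s g) n ≡ Δ^ t g n
Δ^-Sum^-above t s g n = trans (Δ^-+ t s (Sum^ s g) n) (Δ^-cong t Δ^s-Sum^s n)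
  where
  Δ^s-Sum^s : ∀ n → Δ^ s (Sum^ s g) n ≡ g n
  Δ^s-Sum^s n = subst (λ r → Δ^ s (Sum^ r g) n ≡ g n) (ℕ.+-identityʳ s) (Δ^-Sum^ s 0 g n)

Δ^-Sum^-vector : ∀ i s g →
  (i < s × Δ^ i (Sum^ s g) 0 ≡ + 0) ⊎ (∃ λ t → i ≡ t + s × Δ^ i (Sum^ s g) 0 ≡ Δ^ t g 0)
Δ^-Sum^-vector i s g with i ℕ.<? s
... | yes i<s = inj₁ (i<s , Δ^-Sum^-below g i<s)
... | no  i≮s = inj₂ (i ∸ s , sym i∸s+s≡i ,
                     subst (λ j → Δ^ j (Sum^ s g) 0 ≡ Δ^ (i ∸ s) g 0) i∸s+s≡i (Δ^-Sum^-above (i ∸ s) s g 0))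
  where
  i∸s+s≡i : i ∸ s + s ≡ i
  i∸s+s≡i = ℕ.m∸n+n≡m (ℕ.≮⇒≥ i≮s)

∑-pascal : ∀ N T (y : ℕ → ℤ) →
  ∑[ j < suc N ] (+ (suc T C j) ℤ.* y j) ≡
  ∑[ j < suc N ] (+ (T C j) ℤ.* y j) ℤ.+ ∑[ j < N ] (+ (T C j) ℤ.* y (suc j))
∑-pascal N T y = begin
  + 1 ℤ.* y 0 ℤ.+ ∑[ j < N ] (+ (suc T C suc j) ℤ.* y (suc j))
    ≡⟨ cong (+ 1 ℤ.* y 0 ℤ.+_) (∑-cong N split) ⟩
  + 1 ℤ.* y 0 ℤ.+ ∑[ j < N ] (+ (T C j) ℤ.* y (suc j) ℤ.+ + (T C suc j) ℤ.* y (suc j))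
    ≡⟨ cong (+ 1 ℤ.* y 0 ℤ.+_) (∑-distrib-+ N _ _) ⟩
  + 1 ℤ.* y 0 ℤ.+ (A ℤ.+ B)
    ≡⟨ regroup (+ 1 ℤ.* y 0) A B ⟩
  (+ 1 ℤ.* y 0 ℤ.+ B) ℤ.+ A  ∎
  where
  open ≡-Reasoning
  A = ∑[ j < N ] (+ (T C j) ℤ.* y (suc j))
  B = ∑[ j < N ] (+ (T C suc j) ℤ.* y (suc j))
  split : ∀ j → + (suc T C suc j) ℤ.* y (suc j) ≡
                + (T C j) ℤ.* y (suc j) ℤ.+ + (T C suc j) ℤ.* y (suc j)
  split j = begin
    + (suc T C suc j) ℤ.* y (suc j)
      ≡⟨ cong (λ c → + c ℤ.* y (suc j)) (sym (nCk+nC[k+1]≡[n+1]C[k+1] T j)) ⟩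
    + (T C j + T C suc j) ℤ.* y (suc j)
      ≡⟨ cong (ℤ._* y (suc j)) (ℤᵖ.pos-+ (T C j) (T C suc j)) ⟩
    (+ (T C j) ℤ.+ + (T C suc j)) ℤ.* y (suc j)
      ≡⟨ ℤᵖ.*-distribʳ-+ (y (suc j)) (+ (T C j)) (+ (T C suc j)) ⟩
    + (T C j) ℤ.* y (suc j) ℤ.+ + (T C suc j) ℤ.* y (suc j) ∎
  regroup : ∀ a b c → a ℤ.+ (b ℤ.+ c) ≡ (a ℤ.+ c) ℤ.+ b
  regroup = solve-∀

newton : ∀ T g n → g (n + T) ≡ ∑[ j < suc T ] (+ (T C j) ℤ.* Δ^ j g n)
newton zero    g n = begin
  g (n + 0)            ≡⟨ cong g (ℕ.+-identityʳ n) ⟩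
  g n                  ≡⟨ unit (g n) ⟩
  + 1 ℤ.* g n ℤ.+ + 0  ∎
  where
  open ≡-Reasoning
  unit : ∀ a → a ≡ + 1 ℤ.* a ℤ.+ + 0
  unit = solve-∀
newton (suc T) g n = begin
  g (n + suc T)
    ≡⟨ cong g (ℕ.+-suc n T) ⟩
  g (suc n + T)
    ≡⟨ newton T g (suc n) ⟩
  ∑[ j < suc T ] (c j ℤ.* Δ^ j g (suc n))
    ≡⟨ ∑-cong (suc T) (λ j → trans (cong (c j ℤ.*_) (Δ^-step j g n))
                                   (ℤᵖ.*-distribˡ-+ (c j) (y j) (y (suc j)))) ⟩
  ∑[ j < suc T ] (c j ℤ.* y j ℤ.+ c j ℤ.* y (suc j))
    ≡⟨ ∑-distrib-+ (suc T) (λ j → c j ℤ.* y j) (λ j → c j ℤ.* y (suc j)) ⟩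
  ∑[ j < suc T ] (c j ℤ.* y j) ℤ.+ ∑[ j < suc T ] (c j ℤ.* y (suc j))
    ≡⟨ cong (ℤ._+ ∑[ j < suc T ] (c j ℤ.* y (suc j))) (sym extend) ⟩
  ∑[ j < suc (suc T) ] (c j ℤ.* y j) ℤ.+ ∑[ j < suc T ] (c j ℤ.* y (suc j))
    ≡⟨ sym (∑-pascal (suc T) T y) ⟩
  ∑[ j < suc (suc T) ] (+ (suc T C j) ℤ.* y j) ∎
  where
  open ≡-Reasoning
  c : ℕ → ℤ
  c j = + (T C j)
  y : ℕ → ℤ
  y j = Δ^ j g n
  extend : ∑[ j < suc (suc T) ] (c j ℤ.* y j) ≡ ∑[ j < suc T ] (c j ℤ.* y j)
  extend = begin
    ∑[ j < suc (suc T) ] (c j ℤ.* y j)                    ≡⟨ ∑-snoc (suc T) (λ j → c j ℤ.* y j) ⟩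
    ∑[ j < suc T ] (c j ℤ.* y j) ℤ.+ c (suc T) ℤ.* y (suc T)
      ≡⟨ cong (λ z → ∑[ j < suc T ] (c j ℤ.* y j) ℤ.+ + z ℤ.* y (suc T)) (k>n⇒nCk≡0 (ℕ.n<1+n T)) ⟩
    ∑[ j < suc T ] (c j ℤ.* y j) ℤ.+ + 0 ℤ.* y (suc T)    ≡⟨ ℤᵖ.+-identityʳ _ ⟩
    ∑[ j < suc T ] (c j ℤ.* y j)                          ∎

Δ^-increment : ∀ T k g →
  Δ^ k g T ℤ.- Δ^ k g 0 ≡ ∑[ j < T ] (+ (T C suc j) ℤ.* Δ^ (suc j + k) g 0)
Δ^-increment T k g = begin
  Δ^ k g T ℤ.- Δ^ k g 0
    ≡⟨ cong (ℤ._- Δ^ k g 0) (newton T (Δ^ k g) 0) ⟩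
  (+ 1 ℤ.* Δ^ k g 0 ℤ.+ ∑[ j < T ] (+ (T C suc j) ℤ.* Δ^ (suc j) (Δ^ k g) 0)) ℤ.- Δ^ k g 0
    ≡⟨ cancel (Δ^ k g 0) _ ⟩
  ∑[ j < T ] (+ (T C suc j) ℤ.* Δ^ (suc j) (Δ^ k g) 0)
    ≡⟨ ∑-cong T (λ j → cong (+ (T C suc j) ℤ.*_) (sym (Δ^-+ (suc j) k g 0))) ⟩
  ∑[ j < T ] (+ (T C suc j) ℤ.* Δ^ (suc j + k) g 0) ∎
  where
  open ≡-Reasoning
  cancel : ∀ a s → (+ 1 ℤ.* a ℤ.+ s) ℤ.- a ≡ s
  cancel = solve-∀

-- Periods

-- Unlike IsPeriod this admits T = 0, so that periods are closed under multiples and gcd.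
Period : ℕ → Seq → ℕ → Set
Period m g T = ∀ n → + m ∣ℤ g (n + T) ℤ.- g n

period⇔Δ^-increments : ∀ m g T → Period m g T ⇔ (∀ k → + m ∣ℤ Δ^ k g T ℤ.- Δ^ k g 0)
period⇔Δ^-increments m g T = mk⇔
  (λ period k → subst (_ ∣ℤ_) (Δ^-of-increments k T g 0) (Δ^-∣ k period 0))
  (λ increments n → subst (_ ∣ℤ_) (sym (cong₂ ℤ._-_ (g[n+T] n) (newton n g 0)))
     (∑-cong-mod (suc n) {λ j → + (n C j) ℤ.* Δ^ j g T} {λ j → + (n C j) ℤ.* Δ^ j g 0} λ j →
        subst (_ ∣ℤ_) (factor (+ (n C j)) (Δ^ j g T) (Δ^ j g 0))
              (ℤᵈ.∣n⇒∣m*n (+ (n C j)) (increments j))))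
  where
  factor : ∀ c a b → c ℤ.* (a ℤ.- b) ≡ c ℤ.* a ℤ.- c ℤ.* b
  factor = solve-∀
  g[n+T] : ∀ n → g (n + T) ≡ ∑[ j < suc n ] (+ (n C j) ℤ.* Δ^ j g T)
  g[n+T] n = trans (cong g (ℕ.+-comm n T)) (newton n g T)

period⇔∑ : ∀ m g T →
  Period m g T ⇔ (∀ k → + m ∣ℤ ∑[ j < T ] (+ (T C suc j) ℤ.* Δ^ (suc j + k) g 0))
period⇔∑ m g T = mk⇔
  (λ period k → subst (_ ∣ℤ_) (Δ^-increment T k g) (Equivalence.to (period⇔Δ^-increments m g T) period k))
  (λ sums → Equivalence.from (period⇔Δ^-increments m g T) λ k →
     subst (_ ∣ℤ_) (sym (Δ^-increment T k g)) (sums k))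

module _ {m : ℕ} {g : Seq} where

  period-0 : Period m g 0
  period-0 n = subst (λ i → + m ∣ℤ g i ℤ.- g n) (sym (ℕ.+-identityʳ n))
                     (subst (_ ∣ℤ_) (sym (ℤᵖ.+-inverseʳ (g n))) ∣ℤ0)

  period-+ : ∀ {A B} → Period m g A → Period m g B → Period m g (A + B)
  period-+ {A} {B} period-A period-B n =
    subst (λ i → + m ∣ℤ g i ℤ.- g n) (ℕ.+-assoc n A B)
      (subst (_ ∣ℤ_) (telescope (g (n + A + B)) (g (n + A)) (g n))
        (ℤᵈ.∣m∣n⇒∣m+n (period-B (n + A)) (period-A n)))
    where
    telescope : ∀ a b c → (a ℤ.- b) ℤ.+ (b ℤ.- c) ≡ a ℤ.- c
    telescope = solve-∀

  period-* : ∀ x {T} → Period m g T → Period m g (x * T)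
  period-* zero    period-T = period-0
  period-* (suc x) period-T = period-+ period-T (period-* x period-T)

  period-∣ : ∀ {T U} → Period m g T → T ∣ U → Period m g U
  period-∣ period-T (divides-refl x) = period-* x period-T

  period-+-cancelʳ : ∀ {d A} → Period m g (d + A) → Period m g A → Period m g d
  period-+-cancelʳ {d} {A} period-d+A period-A n =
    subst (_ ∣ℤ_) (telescope (g (n + d + A)) (g (n + d)) (g n))
      (ℤᵈ.∣m∣n⇒∣m-n (subst (λ i → + m ∣ℤ g i ℤ.- g n) (sym (ℕ.+-assoc n d A)) (period-d+A n))
                 (period-A (n + d)))
    where
    telescope : ∀ a b c → (a ℤ.- c) ℤ.- (a ℤ.- b) ≡ b ℤ.- c
    telescope = solve-∀

  period-gcd : ∀ {T U} → Period m g T → Period m g U → Period m g (gcd T U)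
  period-gcd {T} {U} period-T period-U with Bézout.identity (gcd-GCD T U)
  ... | Bézout.+- x y eq = period-+-cancelʳ (subst (Period m g) (sym eq) (period-* x period-T))
                                           (period-* y period-U)
  ... | Bézout.-+ x y eq = period-+-cancelʳ (subst (Period m g) (sym eq) (period-* y period-U))
                                           (period-* x period-T)

vanishing-Δ-vector : ∀ {k} g → (∀ i → k ∣ℤ Δ^ i g 0) → ∀ n → k ∣ℤ g n
vanishing-Δ-vector {k} g k∣Δ^g n =
  subst (k ∣ℤ_) (sym (newton n g 0)) (∑-∣ (suc n) λ j → ℤᵈ.∣n⇒∣m*n (+ (n C j)) (k∣Δ^g j))

vanishing-Δ-vector⇒Sum^-periods : ∀ {m} s g → (∀ i → + m ∣ℤ Δ^ i g 0) → ∀ T → Period m (Sum^ s g) T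
vanishing-Δ-vector⇒Sum^-periods {m} s g m∣Δ^g T n =
  ℤᵈ.∣m∣n⇒∣m-n (vanishes (n + T)) (vanishes n)
  where
  m∣Δ^Sum^g : ∀ i → + m ∣ℤ Δ^ i (Sum^ s g) 0
  m∣Δ^Sum^g i with Δ^-Sum^-vector i s g
  ... | inj₁ (_ , a≡0)     = subst (+ m ∣ℤ_) (sym a≡0) ∣ℤ0
  ... | inj₂ (t , _ , a≡e) = subst (+ m ∣ℤ_) (sym a≡e) (m∣Δ^g t)
  vanishes : ∀ n → + m ∣ℤ Sum^ s g n
  vanishes = vanishing-Δ-vector (Sum^ s g) m∣Δ^Sum^g

-- Prime powers and binomial coefficients

[1+k]*nC[1+k]≡n*[n-1]Ck : ∀ n k → .{{_ : NonZero n}} → suc k * (n C suc k) ≡ n * (pred n C k)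
[1+k]*nC[1+k]≡n*[n-1]Ck (suc zero)    zero    = refl
[1+k]*nC[1+k]≡n*[n-1]Ck (suc zero)    (suc k) = ℕ.*-zeroʳ (suc (suc k))
[1+k]*nC[1+k]≡n*[n-1]Ck (suc (suc n)) zero    =
  trans (ℕ.*-identityˡ (suc (suc n) C 1)) (trans (nC1≡n (suc (suc n))) (sym (ℕ.*-identityʳ (suc (suc n)))))
[1+k]*nC[1+k]≡n*[n-1]Ck (suc (suc n)) (suc k) = begin
  suc (suc k) * (suc (suc n) C suc (suc k))
    ≡⟨ cong (suc (suc k) *_) (sym (nCk+nC[k+1]≡[n+1]C[k+1] (suc n) (suc k))) ⟩
  suc (suc k) * (suc n C suc k + suc n C suc (suc k))
    ≡⟨ spread (suc n C suc k) (suc n C suc (suc k)) k ⟩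
  suc n C suc k + (suc k * (suc n C suc k) + suc (suc k) * (suc n C suc (suc k)))
    ≡⟨ cong₂ _+_ (refl {x = suc n C suc k})
                 (cong₂ _+_ ([1+k]*nC[1+k]≡n*[n-1]Ck (suc n) k) ([1+k]*nC[1+k]≡n*[n-1]Ck (suc n) (suc k))) ⟩
  suc n C suc k + (suc n * (n C k) + suc n * (n C suc k))
    ≡⟨ cong (λ c → c + (suc n * (n C k) + suc n * (n C suc k))) (sym (nCk+nC[k+1]≡[n+1]C[k+1] n k)) ⟩
  (n C k + n C suc k) + (suc n * (n C k) + suc n * (n C suc k))
    ≡⟨ collect (n C k) (n C suc k) n ⟩
  suc (suc n) * (n C k + n C suc k)
    ≡⟨ cong (suc (suc n) *_) (nCk+nC[k+1]≡[n+1]C[k+1] n k) ⟩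
  suc (suc n) * (suc n C suc k) ∎
  where
  open ≡-Reasoning
  spread : ∀ a b k → suc (suc k) * (a + b) ≡ a + (suc k * a + suc (suc k) * b)
  spread = ℕ-solve-∀
  collect : ∀ a b n → (a + b) + (suc n * a + suc n * b) ≡ suc (suc n) * (a + b)
  collect = ℕ-solve-∀

^-monoʳ-∣ : ∀ m {a b} → a ≤ b → m ^ a ∣ m ^ b
^-monoʳ-∣ m {a} {b} a≤b =
  subst (λ c → m ^ a ∣ m ^ c) (ℕ.m+[n∸m]≡n a≤b)
        (subst (m ^ a ∣_) (sym (ℕ.^-distribˡ-+-* m a (b ∸ a))) (m∣m*n (m ^ (b ∸ a))))

module _ {p : ℕ} (p-prime : Prime p) where

  instance
    p≢0 : NonZero p
    p≢0 = prime⇒nonZero p-prime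

  p^-≢0 : ∀ a → NonZero (p ^ a)
  p^-≢0 a = ℕ.m^n≢0 p a

  1<p : 1 < p
  1<p = nonTrivial⇒n>1 p {{prime⇒nonTrivial p-prime}}

  twice≤p* : ∀ m → m + m ≤ p * m
  twice≤p* m = subst (_≤ p * m) (cong (λ x → m + x) (ℕ.+-identityʳ m)) (ℕ.*-monoˡ-≤ m 1<p)

  p∤1 : ¬ p ∣ 1
  p∤1 p∣1 = ℕ.<⇒≢ 1<p (sym (∣1⇒≡1 p∣1))

  p^a∣m*n⇒p∤m⇒p^a∣n : ∀ a {m n} → p ^ a ∣ m * n → ¬ p ∣ m → p ^ a ∣ n
  p^a∣m*n⇒p∤m⇒p^a∣n zero    {m} {n} _      _   = 1∣ n
  p^a∣m*n⇒p∤m⇒p^a∣n (suc a) {m} {n} p^a∣mn p∤m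
    with euclidsLemma m n p-prime (m*n∣⇒m∣ p (p ^ a) p^a∣mn)
  ... | inj₁ p∣m = ⊥-elim (p∤m p∣m)
  ... | inj₂ (divides-refl n′) =
    subst (p ^ suc a ∣_) (ℕ.*-comm p n′)
      (*-monoʳ-∣ p (p^a∣m*n⇒p∤m⇒p^a∣n a (*-cancelˡ-∣ p (subst (p ^ suc a ∣_) (shuffle m n′ p) p^a∣mn)) p∤m))
    where
    shuffle : ∀ m n p → m * (n * p) ≡ p * (m * n)
    shuffle = ℕ-solve-∀

  p^[a+b]∣m*n⇒p^[1+b]∤m⇒p^a∣n : ∀ a b {m n} → p ^ (a + b) ∣ m * n → ¬ p ^ suc b ∣ m → p ^ a ∣ n
  p^[a+b]∣m*n⇒p^[1+b]∤m⇒p^a∣n a zero {m} {n} p^a∣mn p∤m =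
    p^a∣m*n⇒p∤m⇒p^a∣n a (subst (λ c → p ^ c ∣ m * n) (ℕ.+-identityʳ a) p^a∣mn)
                         (p∤m ∘ subst (_∣ m) (sym (ℕ.*-identityʳ p)))
  p^[a+b]∣m*n⇒p^[1+b]∤m⇒p^a∣n a (suc b) {m} {n} p^[a+b]∣mn p^[1+b]∤m with p ∣? m
  ... | no p∤m = ∣-trans (^-monoʳ-∣ p (ℕ.m≤m+n a (suc b))) (p^a∣m*n⇒p∤m⇒p^a∣n (a + suc b) p^[a+b]∣mn p∤m)
  ... | yes (divides-refl m′) =
    p^[a+b]∣m*n⇒p^[1+b]∤m⇒p^a∣n a b
      (*-cancelˡ-∣ p (subst₂ _∣_ (cong (p ^_) (ℕ.+-suc a b)) (shuffle m′ p n) p^[a+b]∣mn))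
      (p^[1+b]∤m ∘ subst (p ^ suc (suc b) ∣_) (ℕ.*-comm p m′) ∘ *-monoʳ-∣ p)
    where
    shuffle : ∀ m p n → m * p * n ≡ p * (m * n)
    shuffle = ℕ-solve-∀

  ∣p^[1+k]⇒∣p^k⊎p^[1+k]∣ : ∀ k {d} → d ∣ p ^ suc k → d ∣ p ^ k ⊎ p ^ suc k ∣ d
  ∣p^[1+k]⇒∣p^k⊎p^[1+k]∣ k {d} (divides e p^[1+k]≡e*d) with p ^ suc k ∣? d
  ... | yes p^[1+k]∣d = inj₂ p^[1+k]∣d
  ... | no  p^[1+k]∤d with p^[a+b]∣m*n⇒p^[1+b]∤m⇒p^a∣n 1 k
                             (divides 1 (trans (ℕ.*-comm d e) (trans (sym p^[1+k]≡e*d) (sym (ℕ.*-identityˡ _)))))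
                             p^[1+k]∤d
  ... | divides e′ refl = inj₁ (divides e′ (ℕ.*-cancelˡ-≡ (p ^ k) (e′ * d) p (begin
    p * p ^ k       ≡⟨ p^[1+k]≡e*d ⟩
    e′ * (p * 1) * d ≡⟨ shuffle e′ p d ⟩
    p * (e′ * d)    ∎)))
    where
    open ≡-Reasoning
    shuffle : ∀ e p d → e * (p * 1) * d ≡ p * (e * d)
    shuffle = ℕ-solve-∀

  p^a∣p^[a+b]Cj : ∀ a b {j} → 0 < j → j < p ^ suc b → p ^ a ∣ p ^ (a + b) C j
  p^a∣p^[a+b]Cj a b {suc j} _ j<p^[1+b] =
    p^[a+b]∣m*n⇒p^[1+b]∤m⇒p^a∣n a b
      (divides (pred (p ^ (a + b)) C j)
               (trans ([1+k]*nC[1+k]≡n*[n-1]Ck (p ^ (a + b)) j {{p^-≢0 (a + b)}}) (ℕ.*-comm (p ^ (a + b)) _)))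
      (>⇒∤ j<p^[1+b])

  p^[1+a]∣p^[a+b]Cj : ∀ a b {j} → 0 < j → j < p ^ b → p ^ suc a ∣ p ^ (a + b) C j
  p^[1+a]∣p^[a+b]Cj a zero    (s≤s z≤n) (s≤s ())
  p^[1+a]∣p^[a+b]Cj a (suc b) {j} 0<j j<p^[1+b] =
    subst (λ e → p ^ suc a ∣ p ^ e C j) (sym (ℕ.+-suc a b)) (p^a∣p^[a+b]Cj (suc a) b 0<j j<p^[1+b])

  p∤[p^m-1]Ck : ∀ m {k} → k < p ^ m → ¬ p ∣ pred (p ^ m) C k
  p∤[p^m-1]Ck m {zero}  _ = p∤1
  p∤[p^m-1]Ck zero    {suc k} (s≤s ())
  p∤[p^m-1]Ck (suc b) {suc k} k<p^m p∣C =
    p∤[p^m-1]Ck (suc b) (ℕ.<-trans (ℕ.n<1+n k) k<p^m) (∣m+n∣m⇒∣n p∣Pascal p∣C)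
    where
    p∣Pascal : p ∣ pred (p ^ suc b) C suc k + pred (p ^ suc b) C k
    N = pred (p ^ suc b)
    p∣Pascal = subst (p ∣_) (trans (cong (_C suc k) (sym (ℕ.suc-pred (p ^ suc b) {{p^-≢0 (suc b)}})))
                                   (sym (trans (ℕ.+-comm (N C suc k) (N C k)) (nCk+nC[k+1]≡[n+1]C[k+1] N k))))
                     (m*n∣⇒m∣ p 1 (p^a∣p^[a+b]Cj 1 b (s≤s z≤n) k<p^m))

  p^[w+L]Cp^L≡p^w*u : ∀ w L → ∃ λ u → ¬ p ∣ u × p ^ (w + L) C p ^ L ≡ p ^ w * u
  p^[w+L]Cp^L≡p^w*u w L =
    u , p∤[p^m-1]Ck (w + L) pred[p^L]<p^[w+L] ,
    ℕ.*-cancelˡ-≡ _ _ (p ^ L) {{p^-≢0 L}} (begin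
      p ^ L * (p ^ (w + L) C p ^ L)                 ≡⟨ cong (λ c → c * (p ^ (w + L) C c)) (sym suc-pred[p^L]) ⟩
      suc (pred (p ^ L)) * (p ^ (w + L) C suc (pred (p ^ L)))
                                                    ≡⟨ [1+k]*nC[1+k]≡n*[n-1]Ck (p ^ (w + L)) (pred (p ^ L)) {{p^-≢0 (w + L)}} ⟩
      p ^ (w + L) * u                               ≡⟨ cong (_* u) (ℕ.^-distribˡ-+-* p w L) ⟩
      p ^ w * p ^ L * u                             ≡⟨ shuffle (p ^ w) (p ^ L) u ⟩
      p ^ L * (p ^ w * u)                           ∎)
    where
    open ≡-Reasoning
    u = pred (p ^ (w + L)) C pred (p ^ L)
    suc-pred[p^L] : suc (pred (p ^ L)) ≡ p ^ L
    suc-pred[p^L] = ℕ.suc-pred (p ^ L) {{p^-≢0 L}}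
    pred[p^L]<p^[w+L] : pred (p ^ L) < p ^ (w + L)
    pred[p^L]<p^[w+L] = ℕ.<-≤-trans (ℕ.≤-reflexive suc-pred[p^L]) (ℕ.^-monoʳ-≤ p (ℕ.m≤n+m L w))
    shuffle : ∀ x y z → x * y * z ≡ y * (x * z)
    shuffle = ℕ-solve-∀

  p^L≤n<p^[1+L] : ∀ n → 0 < n → ∃ λ L → p ^ L ≤ n × n < p ^ suc L
  p^L≤n<p^[1+L] (suc zero)    _ = 0 , ℕ.≤-refl , ℕ.<-≤-trans 1<p (ℕ.≤-reflexive (sym (ℕ.*-identityʳ p)))
  p^L≤n<p^[1+L] (suc (suc n)) _ with p^L≤n<p^[1+L] (suc n) (s≤s z≤n)
  ... | L , p^L≤1+n , 1+n<p^[1+L] with suc (suc n) ℕ.<? p ^ suc L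
  ...   | yes 2+n<p^[1+L] = L , ℕ.m≤n⇒m≤1+n p^L≤1+n , 2+n<p^[1+L]
  ...   | no  2+n≮p^[1+L] = suc L , ℕ.≤-reflexive (sym 2+n≡p^[1+L]) ,
          subst (_< p ^ suc (suc L)) (sym 2+n≡p^[1+L]) (ℕ.^-monoʳ-< p 1<p (ℕ.n<1+n (suc L)))
    where
    2+n≡p^[1+L] : suc (suc n) ≡ p ^ suc L
    2+n≡p^[1+L] = ℕ.≤-antisym 1+n<p^[1+L] (ℕ.≮⇒≥ 2+n≮p^[1+L])

  valuation-capped : ∀ ℓ x → ∃ λ v → v ≤ ℓ × p ^ v ∣ x × (v < ℓ → ¬ p ^ suc v ∣ x)
  valuation-capped zero    x = 0 , z≤n , 1∣ x , λ ()
  valuation-capped (suc ℓ) x with valuation-capped ℓ x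
  ... | v , v≤ℓ , p^v∣x , maximal with v ℕ.<? ℓ | p ^ suc v ∣? x
  ...   | yes v<ℓ | _           = v , ℕ.m≤n⇒m≤1+n v≤ℓ , p^v∣x , λ _ → maximal v<ℓ
  ...   | no  v≮ℓ | yes p^[1+v]∣x =
    suc v , s≤s v≤ℓ , p^[1+v]∣x , λ 1+v<1+ℓ → ⊥-elim (v≮ℓ (ℕ.≤-pred 1+v<1+ℓ))
  ...   | no  _   | no  p^[1+v]∤x = v , ℕ.m≤n⇒m≤1+n v≤ℓ , p^v∣x , λ _ → p^[1+v]∤x

  p^[1+M]∣period : ∀ {m g M T} → Period m g (p ^ suc M) → ¬ Period m g (p ^ M) → Period m g T →
                   p ^ suc M ∣ T
  p^[1+M]∣period {m} {g} {M} {T} period-p^[1+M] not-period-p^M period-T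
    with ∣p^[1+k]⇒∣p^k⊎p^[1+k]∣ M (gcd[m,n]∣n T (p ^ suc M))
  ... | inj₁ gcd∣p^M      =
    ⊥-elim (not-period-p^M (period-∣ {g = g} (period-gcd {g = g} period-T period-p^[1+M]) gcd∣p^M))
  ... | inj₂ p^[1+M]∣gcd = ∣-trans p^[1+M]∣gcd (gcd[m,n]∣m T (p ^ suc M))

  -- Periods from the valuation profile of the difference vector

  p^[α+β]∣c*x : ∀ {α β c} {x : ℤ} → p ^ α ∣ c → p ^ β ∣ ℤ.∣ x ∣ → + (p ^ (α + β)) ∣ℤ + c ℤ.* x
  p^[α+β]∣c*x {α} {β} {c} {x} p^α∣c p^β∣x = ℤᵈ.∣ᵤ⇒∣
    (subst₂ _∣_ (sym (ℕ.^-distribˡ-+-* p α β)) (sym (ℤᵖ.abs-* (+ c) x)) (*-pres-∣ p^α∣c p^β∣x))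

  p^[1+v+w]∤p^[w+L]Cp^L*x : ∀ {v w L} {x : ℤ} → ¬ p ^ suc v ∣ ℤ.∣ x ∣ →
                            ¬ + (p ^ (suc v + w)) ∣ℤ + (p ^ (w + L) C p ^ L) ℤ.* x
  p^[1+v+w]∤p^[w+L]Cp^L*x {v} {w} {L} {x} p^[1+v]∤x p^[1+v+w]∣Cx with p^[w+L]Cp^L≡p^w*u w L
  ... | u , p∤u , C≡p^w*u = p^[1+v]∤x (p^a∣m*n⇒p∤m⇒p^a∣n (suc v) p^[1+v]∣ux p∤u)
    where
    p^[1+v]∣ux : p ^ suc v ∣ u * ℤ.∣ x ∣
    p^[1+v]∣ux = *-cancelˡ-∣ (p ^ w) {{p^-≢0 w}} (subst₂ _∣_
      (trans (cong (p ^_) (ℕ.+-comm (suc v) w)) (ℕ.^-distribˡ-+-* p w (suc v)))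
      (trans (trans (ℤᵖ.abs-* (+ (p ^ (w + L) C p ^ L)) x) (cong (_* ℤ.∣ x ∣) C≡p^w*u)) (ℕ.*-assoc (p ^ w) u _))
      (ℤᵈ.∣⇒∣ᵤ p^[1+v+w]∣Cx))

  -- The modulus is p^ℓ with ℓ = 1 + v + w; the periods turn out to be the multiples of
  -- p^(1+w+L) = p^(ℓ−v+L).
  record ValuationProfile (v w d L : ℕ) (a : ℕ → ℤ) : Set where
    field
      p^L≤d     : p ^ L ≤ d
      d<p^[1+L] : d < p ^ suc L
      p^v∣      : ∀ i → p ^ v ∣ ℤ.∣ a i ∣
      p^[1+v]∣  : ∀ i → d < i → p ^ suc v ∣ ℤ.∣ a i ∣
      p^[1+v]∤  : ¬ p ^ suc v ∣ ℤ.∣ a d ∣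
      p^ℓ∣      : ∀ i → d + p ^ L ≤ i → p ^ (suc v + w) ∣ ℤ.∣ a i ∣

  module _ {v w d L} {g : Seq} (profile : ValuationProfile v w d L (λ i → Δ^ i g 0)) where
    open ValuationProfile profile

    private
      ℓ : ℕ
      ℓ = suc v + w

      a : ℕ → ℤ
      a i = Δ^ i g 0

      term-∣ : ∀ α β c i → α + β ≡ ℓ → p ^ α ∣ c → p ^ β ∣ ℤ.∣ a i ∣ → + (p ^ ℓ) ∣ℤ + c ℤ.* a i
      term-∣ α β c i α+β≡ℓ p^α∣c p^β∣a =
        subst (λ e → + (p ^ e) ∣ℤ + c ℤ.* a i) α+β≡ℓ (p^[α+β]∣c*x {α} {β} {c} {a i} p^α∣c p^β∣a)

      term-∣-below : ∀ c i → p ^ suc w ∣ c → + (p ^ ℓ) ∣ℤ + c ℤ.* a i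
      term-∣-below c i p^[1+w]∣c = term-∣ (suc w) v c i (cong suc (ℕ.+-comm w v)) p^[1+w]∣c (p^v∣ i)

      term-∣-above : ∀ c i → d < i → p ^ w ∣ c → + (p ^ ℓ) ∣ℤ + c ℤ.* a i
      term-∣-above c i d<i p^w∣c =
        term-∣ w (suc v) c i (trans (ℕ.+-suc w v) (cong suc (ℕ.+-comm w v))) p^w∣c (p^[1+v]∣ i d<i)

      term-∣-tail : ∀ c i → d + p ^ L ≤ i → + (p ^ ℓ) ∣ℤ + c ℤ.* a i
      term-∣-tail c i d+p^L≤i = ℤᵈ.∣n⇒∣m*n (+ c) (ℤᵈ.∣ᵤ⇒∣ (p^ℓ∣ i d+p^L≤i))

      d+p^L<p^[2+L] : d + p ^ L < p ^ suc (suc L)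
      d+p^L<p^[2+L] = ℕ.<-≤-trans (ℕ.+-mono-<-≤ d<p^[1+L] (ℕ.^-monoʳ-≤ p (ℕ.n≤1+n L))) (twice≤p* (p ^ suc L))

      upper-term : ∀ J k → 0 < J → + (p ^ ℓ) ∣ℤ + (p ^ suc (w + L) C J) ℤ.* a (J + k)
      upper-term J k 0<J with d + p ^ L ℕ.≤? J + k | J + k ℕ.≤? d
      ... | yes d+p^L≤i | _       = term-∣-tail (p ^ suc (w + L) C J) (J + k) d+p^L≤i
      ... | no  _       | yes i≤d =
        term-∣-below _ (J + k) (p^a∣p^[a+b]Cj (suc w) L 0<J (ℕ.≤-<-trans (ℕ.m+n≤o⇒m≤o J i≤d) d<p^[1+L]))
      ... | no  d+p^L≰i | no  i≰d =
        term-∣-above _ (J + k) (ℕ.≰⇒> i≰d)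
          (subst (λ e → p ^ w ∣ p ^ e C J) (ℕ.+-suc w L)
                 (p^a∣p^[a+b]Cj w (suc L) 0<J
                   (ℕ.≤-<-trans (ℕ.m≤m+n J k) (ℕ.<-trans (ℕ.≰⇒> d+p^L≰i) d+p^L<p^[2+L]))))

      k₀ : ℕ
      k₀ = d ∸ p ^ L

      p^L+k₀≡d : p ^ L + k₀ ≡ d
      p^L+k₀≡d = ℕ.m+[n∸m]≡n p^L≤d

      lower-term : ∀ J → 0 < J → J ≢ p ^ L → + (p ^ ℓ) ∣ℤ + (p ^ (w + L) C J) ℤ.* a (J + k₀)
      lower-term J 0<J J≢p^L with d + p ^ L ℕ.≤? J + k₀ | ℕ.<-cmp J (p ^ L)
      ... | yes d+p^L≤i | _               = term-∣-tail (p ^ (w + L) C J) (J + k₀) d+p^L≤i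
      ... | no _        | tri≈ _ J≡p^L _ = ⊥-elim (J≢p^L J≡p^L)
      ... | no _        | tri< J<p^L _ _ = term-∣-below _ (J + k₀) (p^[1+a]∣p^[a+b]Cj w L 0<J J<p^L)
      ... | no d+p^L≰i  | tri> _ _ p^L<J =
        term-∣-above _ (J + k₀) (subst (_< J + k₀) p^L+k₀≡d (ℕ.+-monoˡ-< k₀ p^L<J))
          (p^a∣p^[a+b]Cj w L 0<J (ℕ.<-≤-trans J<p^L+p^L (twice≤p* (p ^ L))))
        where
        J<p^L+p^L : J < p ^ L + p ^ L
        J<p^L+p^L = ℕ.+-cancelʳ-< k₀ J (p ^ L + p ^ L) (subst (J + k₀ <_)
          (trans (cong (_+ p ^ L) (sym p^L+k₀≡d)) (shuffle (p ^ L) k₀)) (ℕ.≰⇒> d+p^L≰i))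
          where
          shuffle : ∀ x k → x + k + x ≡ x + x + k
          shuffle = ℕ-solve-∀

    period-p^[1+w+L] : Period (p ^ ℓ) g (p ^ suc (w + L))
    period-p^[1+w+L] = Equivalence.from (period⇔∑ (p ^ ℓ) g (p ^ suc (w + L))) λ k →
      ∑-∣ (p ^ suc (w + L)) λ j → upper-term (suc j) k (s≤s z≤n)

    not-period-p^[w+L] : ¬ Period (p ^ ℓ) g (p ^ (w + L))
    not-period-p^[w+L] period =
      ∑-∤ (p ^ (w + L)) j₀<p^[w+L] others (p^[1+v+w]∤p^[w+L]Cp^L*x {v} {w} {L} p^[1+v]∤ ∘ at-j₀)
          (Equivalence.to (period⇔∑ (p ^ ℓ) g (p ^ (w + L))) period k₀)
      where
      j₀ : ℕ
      j₀ = pred (p ^ L)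

      1+j₀≡p^L : suc j₀ ≡ p ^ L
      1+j₀≡p^L = ℕ.suc-pred (p ^ L) {{p^-≢0 L}}

      j₀<p^[w+L] : j₀ < p ^ (w + L)
      j₀<p^[w+L] = ℕ.<-≤-trans (ℕ.≤-reflexive 1+j₀≡p^L) (ℕ.^-monoʳ-≤ p (ℕ.m≤n+m L w))

      others : ∀ j → j ≢ j₀ → + (p ^ ℓ) ∣ℤ + (p ^ (w + L) C suc j) ℤ.* a (suc j + k₀)
      others j j≢j₀ = lower-term (suc j) (s≤s z≤n) (j≢j₀ ∘ ℕ.suc-injective ∘ flip trans (sym 1+j₀≡p^L))

      at-j₀ : + (p ^ ℓ) ∣ℤ + (p ^ (w + L) C suc j₀) ℤ.* a (suc j₀ + k₀) →
              + (p ^ ℓ) ∣ℤ + (p ^ (w + L) C p ^ L) ℤ.* a d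
      at-j₀ = subst (λ i → + (p ^ ℓ) ∣ℤ + (p ^ (w + L) C p ^ L) ℤ.* a i) p^L+k₀≡d
            ∘ subst (λ J → + (p ^ ℓ) ∣ℤ + (p ^ (w + L) C J) ℤ.* a (J + k₀)) 1+j₀≡p^L

    period⇔p^[1+w+L]∣ : ∀ T → Period (p ^ ℓ) g T ⇔ p ^ suc (w + L) ∣ T
    period⇔p^[1+w+L]∣ T = mk⇔ (p^[1+M]∣period {g = g} {M = w + L} period-p^[1+w+L] not-period-p^[w+L])
                              (period-∣ {g = g} period-p^[1+w+L])

  Sum^-profile : ∀ {v w L s γ η} f →
    (∀ n → + (p ^ (suc v + w)) ∣ℤ Δ^ η f n) →
    (∀ i → i < η → p ^ v ∣ ℤ.∣ Δ^ i f 0 ∣) →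
    (∀ i → γ < i → i < η → p ^ suc v ∣ ℤ.∣ Δ^ i f 0 ∣) →
    ¬ p ^ suc v ∣ ℤ.∣ Δ^ γ f 0 ∣ →
    η ≤ p ^ L → p ^ L ≤ γ + s → γ + s < p ^ suc L →
    ValuationProfile v w (γ + s) L (λ i → Δ^ i (Sum^ s f) 0)
  Sum^-profile {v} {w} {L} {s} {γ} {η} f nilpotent p^v∣e p^[1+v]∣e p^[1+v]∤eγ η≤p^L p^L≤d d<p^[1+L] = record
    { p^L≤d     = p^L≤d
    ; d<p^[1+L] = d<p^[1+L]
    ; p^v∣      = p^v∣
    ; p^[1+v]∣  = p^[1+v]∣
    ; p^[1+v]∤  = subst (λ x → ¬ p ^ suc v ∣ ℤ.∣ x ∣) (sym (Δ^-Sum^-above γ s f 0)) p^[1+v]∤eγ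
    ; p^ℓ∣      = p^ℓ∣
    }
    where
    ℓ = suc v + w

    p^ℓ∣e : ∀ t → η ≤ t → p ^ ℓ ∣ ℤ.∣ Δ^ t f 0 ∣
    p^ℓ∣e t η≤t = ℤᵈ.∣⇒∣ᵤ (Δ^-beyond-nilpotency f nilpotent η≤t)

    below-ℓ : ∀ {k} t → k ≤ ℓ → (t < η → p ^ k ∣ ℤ.∣ Δ^ t f 0 ∣) → p ^ k ∣ ℤ.∣ Δ^ t f 0 ∣
    below-ℓ t k≤ℓ p^k∣e with t ℕ.<? η
    ... | yes t<η = p^k∣e t<η
    ... | no  t≮η = ∣-trans (^-monoʳ-∣ p k≤ℓ) (p^ℓ∣e t (ℕ.≮⇒≥ t≮η))

    p^v∣ : ∀ i → p ^ v ∣ ℤ.∣ Δ^ i (Sum^ s f) 0 ∣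
    p^v∣ i with Δ^-Sum^-vector i s f
    ... | inj₁ (_ , a≡0)     = subst (λ x → p ^ v ∣ ℤ.∣ x ∣) (sym a≡0) ((p ^ v) ∣0)
    ... | inj₂ (t , _ , a≡e) = subst (λ x → p ^ v ∣ ℤ.∣ x ∣) (sym a≡e)
                                 (below-ℓ t (ℕ.m≤n⇒m≤1+n (ℕ.m≤m+n v w)) (p^v∣e t))

    p^[1+v]∣ : ∀ i → γ + s < i → p ^ suc v ∣ ℤ.∣ Δ^ i (Sum^ s f) 0 ∣
    p^[1+v]∣ i d<i with Δ^-Sum^-vector i s f
    ... | inj₁ (i<s , _)       = ⊥-elim (ℕ.<-asym i<s (ℕ.≤-<-trans (ℕ.m≤n+m s γ) d<i))
    ... | inj₂ (t , refl , a≡e) = subst (λ x → p ^ suc v ∣ ℤ.∣ x ∣) (sym a≡e)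
                                   (below-ℓ t (s≤s (ℕ.m≤m+n v w)) (p^[1+v]∣e t (ℕ.+-cancelʳ-< s γ t d<i)))

    p^ℓ∣ : ∀ i → γ + s + p ^ L ≤ i → p ^ ℓ ∣ ℤ.∣ Δ^ i (Sum^ s f) 0 ∣
    p^ℓ∣ i d+p^L≤i with Δ^-Sum^-vector i s f
    ... | inj₁ (i<s , _)        =
      ⊥-elim (ℕ.<⇒≱ i<s (ℕ.≤-trans (ℕ.≤-trans (ℕ.m≤n+m s γ) (ℕ.m≤m+n (γ + s) (p ^ L))) d+p^L≤i))
    ... | inj₂ (t , refl , a≡e) = subst (λ x → p ^ ℓ ∣ ℤ.∣ x ∣) (sym a≡e) (p^ℓ∣e t η≤t)
      where
      reorder : ∀ γ s x → γ + s + x ≡ γ + x + s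
      reorder = ℕ-solve-∀
      η≤t : η ≤ t
      η≤t = ℕ.≤-trans η≤p^L (ℕ.≤-trans (ℕ.m≤n+m (p ^ L) γ)
              (ℕ.+-cancelʳ-≤ s (γ + p ^ L) t (subst (_≤ t + s) (reorder γ s (p ^ L)) d+p^L≤i)))

  Sum^-constant-profile : ∀ {v w L d c} → p ^ v ∣ ℤ.∣ c ∣ → ¬ p ^ suc v ∣ ℤ.∣ c ∣ →
    p ^ L ≤ d → d < p ^ suc L → ValuationProfile v w d L (λ i → Δ^ i (Sum^ d [ c ]) 0)
  Sum^-constant-profile {L = L} {d} {c} p^v∣c p^[1+v]∤c =
    Sum^-profile {s = d} {γ = 0} {η = 1} [ c ] ([c]-nilpotent c)
      (λ { zero _ → p^v∣c ; (suc _) (s≤s ()) })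
      (λ { (suc _) _ (s≤s ()) })
      p^[1+v]∤c (ℕ.m^n>0 p L)

module _ {m : ℕ} where

  IsPeriod-transfer : ∀ g h → (∀ T → Period m g T ⇔ Period m h T) →
                      ∀ T → IsPeriod m g T → IsPeriod m h T
  IsPeriod-transfer g h same T (1≤T , periodic) =
    1≤T , λ n → ℤᵈ.∣⇒∣ᵤ (Equivalence.to (same T) (λ n → ℤᵈ.∣ᵤ⇒∣ (periodic n)) n)

  IsMinPeriod-cong : ∀ g h → (∀ T → Period m g T ⇔ Period m h T) →
                     ∀ T → IsMinPeriod m g T ⇔ IsMinPeriod m h T
  IsMinPeriod-cong g h same T = mk⇔ (transfer g h same) (transfer h g (λ T → ⇔-sym (same T)))
    where
    transfer : ∀ g h → (∀ T → Period m g T ⇔ Period m h T) → IsMinPeriod m g T → IsMinPeriod m h T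
    transfer g h same (period , minimal) =
      IsPeriod-transfer g h same T period ,
      λ T′ period′ → minimal T′ (IsPeriod-transfer h g (λ T → ⇔-sym (same T)) T′ period′)

ValLt⇒p^[1+v]∣ : ∀ {p ℓ v x y} → p ^ v ∣ ℤ.∣ x ∣ → ValLt p ℓ x y → p ^ suc v ∣ ℤ.∣ y ∣
ValLt⇒p^[1+v]∣ {p} {v = v} p^v∣x (k , _ , p^k∣y , p^k∤x) with suc v ℕ.≤? k
... | yes 1+v≤k = ∣-trans (^-monoʳ-∣ p 1+v≤k) p^k∣y
... | no  1+v≰k = ⊥-elim (p^k∤x (∣-trans (^-monoʳ-∣ p (ℕ.≤-pred (ℕ.≰⇒> 1+v≰k))) p^v∣x))

IsZeroSeq⇒∣ : ∀ {m h} → IsZeroSeq m h → ∀ n → + m ∣ℤ h n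
IsZeroSeq⇒∣ {h = h} zero-seq n = subst (_ ∣ℤ_) (ℤᵖ.+-identityʳ (h n)) (ℤᵈ.∣ᵤ⇒∣ (zero-seq n))

module _ {p : ℕ} {f : Seq} {η γ : ℕ} where

  vanishing-leading⇒Sum^-periods : ∀ {ℓ} →
    (∀ n → + (p ^ ℓ) ∣ℤ Δ^ η f n) →
    (∀ i → i < η → ValLe p ℓ (Δ^ γ f 0) (Δ^ i f 0)) →
    p ^ ℓ ∣ ℤ.∣ Δ^ γ f 0 ∣ →
    ∀ s T → Period (p ^ ℓ) (Sum^ s f) T × Period (p ^ ℓ) (Sum^ (s + γ) [ Δ^ γ f 0 ] ) T
  vanishing-leading⇒Sum^-periods {ℓ} nilpotent γ-minimal p^ℓ∣c s T =
    vanishing-Δ-vector⇒Sum^-periods s f f-vector T ,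
    vanishing-Δ-vector⇒Sum^-periods (s + γ) [ Δ^ γ f 0 ] c-vector T
    where
    f-vector : ∀ t → + (p ^ ℓ) ∣ℤ Δ^ t f 0
    f-vector t with t ℕ.<? η
    ... | yes t<η = ℤᵈ.∣ᵤ⇒∣ (γ-minimal t t<η ℓ ℕ.≤-refl p^ℓ∣c)
    ... | no  t≮η = Δ^-beyond-nilpotency f nilpotent (ℕ.≮⇒≥ t≮η)
    c-vector : ∀ t → + (p ^ ℓ) ∣ℤ Δ^ t [ Δ^ γ f 0 ] 0
    c-vector zero    = ℤᵈ.∣ᵤ⇒∣ p^ℓ∣c
    c-vector (suc t) =
      Δ^-beyond-nilpotency {η = 1} {t = suc t} [ Δ^ γ f 0 ] ([c]-nilpotent (Δ^ γ f 0)) (s≤s z≤n)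

  leading-valuation⇒Sum^-periods : ∀ {v w} → Prime p → 0 < η → γ < η →
    (∀ n → + (p ^ (suc v + w)) ∣ℤ Δ^ η f n) →
    (∀ i → i < η → p ^ v ∣ ℤ.∣ Δ^ i f 0 ∣) →
    (∀ i → γ < i → i < η → p ^ suc v ∣ ℤ.∣ Δ^ i f 0 ∣) →
    ¬ p ^ suc v ∣ ℤ.∣ Δ^ γ f 0 ∣ →
    ∀ s → p * η ≤ s → ∀ T →
    Period (p ^ (suc v + w)) (Sum^ s f) T ⇔ Period (p ^ (suc v + w)) (Sum^ (s + γ) [ Δ^ γ f 0 ]) T
  leading-valuation⇒Sum^-periods {v} {w} p-prime 0<η γ<η nilpotent p^v∣e p^[1+v]∣e p^[1+v]∤c s pη≤s T
    with p^L≤n<p^[1+L] p-prime (s + γ)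
           (ℕ.<-≤-trans (ℕ.*-mono-≤ (ℕ.<⇒≤ (1<p p-prime)) 0<η) (ℕ.≤-trans pη≤s (ℕ.m≤m+n s γ)))
  ... | L , p^L≤d , d<p^[1+L] =
    ⇔-trans (period⇔p^[1+w+L]∣ p-prime {v} {w} {γ + s} {L}
               (Sum^-profile p-prime {v} {w} {L} f nilpotent p^v∣e p^[1+v]∣e p^[1+v]∤c η≤p^L
                  (subst (p ^ L ≤_) (ℕ.+-comm s γ) p^L≤d) (subst (_< p ^ suc L) (ℕ.+-comm s γ) d<p^[1+L])) T)
            (⇔-sym (period⇔p^[1+w+L]∣ p-prime {v} {w} {s + γ} {L}
               (Sum^-constant-profile p-prime {v} {w} {L} (p^v∣e γ γ<η) p^[1+v]∤c p^L≤d d<p^[1+L]) T))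
    where
    η≤p^L : η ≤ p ^ L
    η≤p^L = ℕ.<⇒≤ (ℕ.*-cancelˡ-< p η (p ^ L) (ℕ.≤-<-trans pη≤s (ℕ.≤-<-trans (ℕ.m≤m+n s γ) d<p^[1+L])))

theorem3p5 : (p ℓ : ℕ) → Prime p → 1 ≤ ℓ →
    (f : Seq) → Periodic (p ^ ℓ) f →
    (η : ℕ) → IsNilpotencyIndex (p ^ ℓ) f η →
    (γ : ℕ) → IsLeadingIndex p ℓ f η γ →
    ∃ λ s₀ → ∀ s → s₀ ≤ s → ∀ T →
    IsMinPeriod (p ^ ℓ) (Sum^ s f) T ⇔
    IsMinPeriod (p ^ ℓ) (Sum^ (s + γ) [ vectEntry f γ ]) T
theorem3p5 p ℓ p-prime _ f _ η (0<η , Δ^ηf≡0 , _) γ (γ<η , γ-minimal , γ-last)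
  with valuation-capped p-prime ℓ ℤ.∣ vectEntry f γ ∣
... | v , v≤ℓ , p^v∣c , p^[1+v]∤c with v ℕ.<? ℓ
...   | no v≮ℓ = 0 , λ s _ → IsMinPeriod-cong (Sum^ s f) (Sum^ (s + γ) [ vectEntry f γ ]) λ T →
        let periodic = vanishing-leading⇒Sum^-periods (IsZeroSeq⇒∣ Δ^ηf≡0) γ-minimal p^ℓ∣c s T
        in mk⇔ (λ _ → proj₂ periodic) (λ _ → proj₁ periodic)
  where
  p^ℓ∣c : p ^ ℓ ∣ ℤ.∣ vectEntry f γ ∣
  p^ℓ∣c = subst (λ k → p ^ k ∣ ℤ.∣ vectEntry f γ ∣) (ℕ.≤-antisym v≤ℓ (ℕ.≮⇒≥ v≮ℓ)) p^v∣c
...   | yes v<ℓ with ℕ.m≤n⇒∃[o]m+o≡n v<ℓ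
...     | w , refl = p * η , λ s pη≤s → IsMinPeriod-cong (Sum^ s f) (Sum^ (s + γ) [ vectEntry f γ ])
          (leading-valuation⇒Sum^-periods {v = v} {w} p-prime 0<η γ<η (IsZeroSeq⇒∣ Δ^ηf≡0)
             (λ i i<η → γ-minimal i i<η v v≤ℓ p^v∣c)
             (λ i γ<i i<η → ValLt⇒p^[1+v]∣ {v = v} {vectEntry f γ} {vectEntry f i} p^v∣c
                               (γ-last i γ<i i<η))
             (p^[1+v]∤c v<ℓ) s pη≤s)
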